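{- A subset $B$ of $\mathcal C$ is dense in the alternating lexicographic order topology if and only if, for every element $[a_0;a_1,\dots,a_n]$ of $\mathcal C_t$, there exists an element $[b_0;b_1,b_2,\dots]$ of $B$ having at least $n+1$ entries such that $b_j=a_j$ for all $0\le j\le n$.
   Context: Let $\mathcal C_i$ be the set of formal infinite integer sequences $[a_0;a_1,a_2,\dots]$ with $a_j\ge1$ for all $j\ge1$, and $\mathcal C_t$ the set of formal finite integer sequences $[a_0;a_1,\dots,a_n]$ ($n\ge0$) with $a_j\ge1$ for $1\le j\le n$ and $a_n\ge2$ if $n\ge1$; put $\mathcal C=\mathcal C_i\cup\mathcal C_t$. The alternating lexicographic order on $\mathcal C$ is the total order defined as follows: a terminating element $[a_0;a_1,\dots,a_n]$ is treated as $[a_0;a_1,\dots,a_n,+\infty]$; for two distinct elements $a=[a_0;a_1,\dots]$ and $b=[b_0;b_1,\dots]$, let $k$ be the first index with $a_k\ne b_k$; then $a<b$ iff either $k$ is even and $a_k<b_k$, or $k$ is odd and $a_k>b_k$. The alternating lexicographic (alt-lex) order topology on $\mathcal C$ is the order topology of this order: open sets are arbitrary unions of open intervals $(c,d)=\{s\in\mathcal C: c<s<d\}$. -}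

module Defs where

open import Data.Nat using (ℕ; zero; suc) renaming (_<_ to _<ℕ_; _≤_ to _≤ℕ_)
open import Data.Integer using (ℤ; +_; _≤_; _<_)
open import Data.Fin using (Fin; toℕ; fromℕ)
open import Data.Bool using (Bool; true; false; not)
open import Data.Product using (Σ; ∃; _×_; _,_)
open import Data.Empty using (⊥)
open import Relation.Binary.PropositionalEquality using (_≡_)

record Ct : Set where
  constructor mkCt
  field
    len   : ℕ                         -- the index n of the last entry
    entry : Fin (suc len) → ℤ
    pos   : (j : Fin (suc len)) → 1 ≤ℕ toℕ j → + 1 ≤ entry j
    last2 : 1 ≤ℕ len → + 2 ≤ entry (fromℕ len)

data C : Set where
  inf : (a : ℕ → ℤ) → ((j : ℕ) → + 1 ≤ a (suc j)) → C
  fin : Ct → C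

-- Entries of the extended sequence: a terminating [a_0;...;a_n] is read as
-- [a_0;...;a_n,+∞]; positions after the +∞ are "none" (never reached when
-- comparing two distinct elements).
data Entry : Set where
  val  : ℤ → Entry
  ∞    : Entry
  none : Entry

finEntry : (n : ℕ) → (Fin (suc n) → ℤ) → ℕ → Entry
finEntry zero    a zero    = val (a Fin.zero)
finEntry zero    a (suc zero) = ∞
finEntry zero    a (suc (suc k)) = none
finEntry (suc n) a zero    = val (a Fin.zero)
finEntry (suc n) a (suc k) = finEntry n (λ j → a (Fin.suc j)) k

entryAt : C → ℕ → Entry
entryAt (inf a _) k = val (a k)
entryAt (fin (mkCt n a _ _)) k = finEntry n a k

data _<E_ : Entry → Entry → Set where
  val<val : ∀ {x y} → x < y → val x <E val y
  val<∞   : ∀ {x} → val x <E ∞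

isEven : ℕ → Bool
isEven zero    = true
isEven (suc k) = not (isEven k)

cmpAt : Bool → Entry → Entry → Set
cmpAt true  x y = x <E y
cmpAt false x y = y <E x

_≺_ : C → C → Set
a ≺ b = Σ ℕ λ k → ((j : ℕ) → j <ℕ k → entryAt a j ≡ entryAt b j)
                 × cmpAt (isEven k) (entryAt a k) (entryAt b k)

-- open sets of the order topology: unions of open intervals (c,d),
-- i.e. every point of U lies in an open interval contained in U
IsOpen : (C → Set) → Set
IsOpen U = (x : C) → U x →
  Σ C λ c → Σ C λ d → c ≺ x × x ≺ d × ((y : C) → c ≺ y → y ≺ d → U y)

Dense : (C → Set) → Set₁
Dense B = (U : C → Set) → IsOpen U → (Σ C λ x → U x) → Σ C λ y → B y × U y

Extends : C → Ct → Set
Extends b (mkCt n a _ _) = (j : Fin (suc n)) → entryAt b (toℕ j) ≡ val (a j)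

{-# OPTIONS --safe #-}
-- Dense ⇒ extensions: for a = [a₀; …, aₙ], the open interval between [a₀; …, aₙ, 1, 2] and
-- [a₀; …, aₙ, 3, 2] contains [a₀; …, aₙ, 2, 2], and anything strictly between two elements
-- that agree up to index n agrees with them there, hence extends a.
-- Extensions ⇒ dense: if c ≺ x ≺ d with first differences at k and m, let K = max k m.
-- Every element agreeing with x below K whose K-th entry is an integer on the right sides of
-- c_K and d_K lies in (c, d); these include all extensions of [x₀; …, x_{K-1}, w, 2], where
-- w = x_K unless x_K = ∞, in which case any large enough integer will do.
module Submission where

open import Defs
open import Data.Product using (Σ; ∃; _×_; _,_; proj₁; uncurry)
open import Function.Bundles using (_⇔_; mk⇔; Equivalence)
open import Function.Base using (_∘_; id)
open import Data.Nat as ℕ using (ℕ; zero; suc; z≤n; s≤s; _⊔_)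
open import Data.Nat.Properties as ℕₚ
  using (<-cmp; ⊔-sel; m≤m⊔n; m≤n⊔m; m≤n⇒m<n∨m≡n; ≰⇒>)
open import Data.Integer as ℤ using (ℤ; +_; -[1+_]; +≤+; +<+; -<+; ∣_∣)
import Data.Integer.Properties as ℤₚ
open import Data.Fin as Fin using (Fin; toℕ; fromℕ; fromℕ<)
open import Data.Fin.Properties using (toℕ-fromℕ; toℕ-fromℕ<; toℕ<n)
open import Data.Bool using (Bool; true; false)
open import Data.Sum using (inj₁; inj₂)
open import Data.Empty using (⊥; ⊥-elim)
open import Relation.Nullary using (¬_; yes; no)
open import Relation.Binary using (tri<; tri≈; tri>)
open import Relation.Binary.PropositionalEquality
  using (_≡_; _≢_; refl; sym; trans; cong; subst; subst₂; module ≡-Reasoning)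

-- junk value + 1 at ∞ and none, so that `value-pos` needs no side condition
value : Entry → ℤ
value (val v) = v
value ∞       = + 1
value none    = + 1

cmpAt-none-left : ∀ b {e} → ¬ cmpAt b none e
cmpAt-none-left true  ()
cmpAt-none-left false ()

cmpAt-none-right : ∀ b {e} → ¬ cmpAt b e none
cmpAt-none-right true  ()
cmpAt-none-right false ()

<E-asym : ∀ {e f} → e <E f → ¬ f <E e
<E-asym (val<val e<f) (val<val f<e) = ℤₚ.<-asym e<f f<e

cmpAt-asym : ∀ b {e f} → cmpAt b e f → ¬ cmpAt b f e
cmpAt-asym true  = <E-asym
cmpAt-asym false = <E-asym

cmpAt-irrefl : ∀ b {e f} → cmpAt b e f → e ≢ f
cmpAt-irrefl b e<f refl = cmpAt-asym b e<f e<f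

i<1+∣i∣ : ∀ i → i ℤ.< + suc ∣ i ∣
i<1+∣i∣ (+ n)    = +<+ (ℕₚ.n<1+n n)
i<1+∣i∣ -[1+ n ] = -<+

<E-∞⇒<E-val : ∀ {e} → e <E ∞ → e <E val (+ suc ∣ value e ∣)
<E-∞⇒<E-val (val<∞ {u}) = val<val (i<1+∣i∣ u)

record Approximant (b : Bool) (e x f : Entry) : Set where
  constructor approximant
  field
    w        : ℤ
    e<w      : cmpAt b e x → cmpAt b e (val w)
    w<f      : cmpAt b x f → cmpAt b (val w) f
    positive : + 1 ℤ.≤ value x → + 1 ℤ.≤ w

-- ∞ is the top entry, so it can only lie strictly above some val u, as + suc ∣ u ∣ does.
approximate : ∀ b e x f → Approximant b e x f
approximate b     e (val v) f = approximant v id id id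
approximate true  e ∞       f =
  approximant (+ suc ∣ value e ∣) <E-∞⇒<E-val (λ ()) (λ _ → +≤+ (s≤s z≤n))
approximate false e ∞       f =
  approximant (+ suc ∣ value f ∣) (λ ()) <E-∞⇒<E-val (λ _ → +≤+ (s≤s z≤n))
approximate b     e none    f =
  approximant (+ 1) (⊥-elim ∘ cmpAt-none-right b) (⊥-elim ∘ cmpAt-none-left b) id

∀toℕ⇒∀< : ∀ {L} {P : ℕ → Set} → ((i : Fin L) → P (toℕ i)) → ∀ {j} → j ℕ.< L → P j
∀toℕ⇒∀< {P = P} h j<L = subst P (toℕ-fromℕ< j<L) (h (fromℕ< j<L))

finEntry-toℕ : ∀ n (e : Fin (suc n) → ℤ) (i : Fin (suc n)) → finEntry n e (toℕ i) ≡ val (e i)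
finEntry-toℕ zero    e Fin.zero    = refl
finEntry-toℕ (suc n) e Fin.zero    = refl
finEntry-toℕ (suc n) e (Fin.suc i) = finEntry-toℕ n (e ∘ Fin.suc) i

finEntry-val-below : ∀ n (e : Fin (suc n) → ℤ) {j k} → j ℕ.< k → finEntry n e k ≢ none →
  ∃ λ v → finEntry n e j ≡ val v
finEntry-val-below zero    e {zero}                _         _     = e Fin.zero , refl
finEntry-val-below zero    e {suc j} {suc zero}    (s≤s ())
finEntry-val-below zero    e {suc j} {suc (suc k)} _         k-def = ⊥-elim (k-def refl)
finEntry-val-below (suc n) e {zero}                _         _     = e Fin.zero , refl
finEntry-val-below (suc n) e {suc j} {suc k}       (s≤s j<k) k-def =
  finEntry-val-below n (e ∘ Fin.suc) j<k k-def

entryAt-val-below : ∀ x {j k} → j ℕ.< k → entryAt x k ≢ none → ∃ λ v → entryAt x j ≡ val v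
entryAt-val-below (inf a _)            {j} _ _ = a j , refl
entryAt-val-below (fin (mkCt n e _ _)) j<k k-def = finEntry-val-below n e j<k k-def

finEntry-value-pos : ∀ n (e : Fin (suc n) → ℤ) →
  ((i : Fin (suc n)) → 1 ℕ.≤ toℕ i → + 1 ℤ.≤ e i) → ∀ j → + 1 ℤ.≤ value (finEntry n e (suc j))
finEntry-value-pos zero          e pos zero    = ℤₚ.≤-refl
finEntry-value-pos zero          e pos (suc j) = ℤₚ.≤-refl
finEntry-value-pos (suc zero)    e pos zero    = pos (Fin.suc Fin.zero) (s≤s z≤n)
finEntry-value-pos (suc (suc n)) e pos zero    = pos (Fin.suc Fin.zero) (s≤s z≤n)
finEntry-value-pos (suc n)       e pos (suc j) =
  finEntry-value-pos n (e ∘ Fin.suc) (λ i _ → pos (Fin.suc i) (s≤s z≤n)) j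

value-pos : ∀ x {j} → 1 ℕ.≤ j → + 1 ℤ.≤ value (entryAt x j)
value-pos (inf a pos)            {suc j} _ = pos j
value-pos (fin (mkCt n e pos _)) {suc j} _ = finEntry-value-pos n e pos j

record Agree (u v : C) (n : ℕ) : Set where
  constructor agree
  field at : ∀ j → j ℕ.< n → entryAt u j ≡ entryAt v j
open Agree

Agree-sym : ∀ {u v n} → Agree u v n → Agree v u n
Agree-sym (agree u=v) = agree λ j j<n → sym (u=v j j<n)

Agree-trans : ∀ {u v w n} → Agree u v n → Agree v w n → Agree u w n
Agree-trans (agree u=v) (agree v=w) = agree λ j j<n → trans (u=v j j<n) (v=w j j<n)

Agree-≤ : ∀ {u v m n} → m ℕ.≤ n → Agree u v n → Agree u v m
Agree-≤ m≤n (agree u=v) = agree λ j j<m → u=v j (ℕₚ.<-≤-trans j<m m≤n)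

Extends⇔Agree : ∀ b a → Extends b a ⇔ Agree b (fin a) (suc (Ct.len a))
Extends⇔Agree b (mkCt n e _ _) = mk⇔
  (λ b⊒a → agree λ j → ∀toℕ⇒∀< (λ i → trans (b⊒a i) (sym (finEntry-toℕ n e i))))
  (λ b=a i → trans (at b=a (toℕ i) (toℕ<n i)) (finEntry-toℕ n e i))

≺-right-defined : ∀ {c x} → (c≺x : c ≺ x) → entryAt x (proj₁ c≺x) ≢ none
≺-right-defined {c} (k , _ , c<x) x=none =
  cmpAt-none-right (isEven k) (subst (cmpAt (isEven k) (entryAt c k)) x=none c<x)

≺-left-defined : ∀ {x d} → (x≺d : x ≺ d) → entryAt x (proj₁ x≺d) ≢ none
≺-left-defined {d = d} (m , _ , x<d) x=none =
  cmpAt-none-left (isEven m) (subst (λ e → cmpAt (isEven m) e (entryAt d m)) x=none x<d)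

Agree-between : ∀ {p y q n} → p ≺ y → y ≺ q → Agree p q n → Agree p y n
Agree-between {p} {y} {q} {n} (k , p=y , p<y) (l , y=q , y<q) (agree p=q) with n ℕ.≤? k
... | yes n≤k = Agree-≤ n≤k (agree p=y)
... | no  n≰k = ⊥-elim (differ-before (≰⇒> n≰k))
  where
  -- p and q agree below n, so p and y first differing there contradicts y ≺ q
  differ-before : k ℕ.< n → ⊥
  differ-before k<n with <-cmp k l
  ... | tri< k<l _ _ = cmpAt-irrefl (isEven k) p<y (trans (p=q k k<n) (sym (y=q k k<l)))
  ... | tri≈ _ refl _ =
    cmpAt-asym (isEven k) p<y (subst (cmpAt (isEven k) (entryAt y k)) (sym (p=q k k<n)) y<q)
  ... | tri> _ _ l<k =
    cmpAt-irrefl (isEven l) y<q (trans (sym (p=y l l<k)) (p=q l (ℕₚ.<-trans l<k k<n)))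

≺-agree-right : ∀ {c x b K} → (c≺x : c ≺ x) → proj₁ c≺x ℕ.≤ K → Agree x b K →
  (proj₁ c≺x ≡ K → cmpAt (isEven K) (entryAt c K) (entryAt b K)) → c ≺ b
≺-agree-right {c} (k , c=x , c<x) k≤K (agree x=b) c<b with m≤n⇒m<n∨m≡n k≤K
... | inj₁ k<K = k , (λ j j<k → trans (c=x j j<k) (x=b j (ℕₚ.<-trans j<k k<K))) ,
                 subst (cmpAt (isEven k) (entryAt c k)) (x=b k k<K) c<x
... | inj₂ refl = k , (λ j j<k → trans (c=x j j<k) (x=b j j<k)) , c<b refl

≺-agree-left : ∀ {x d b K} → (x≺d : x ≺ d) → proj₁ x≺d ℕ.≤ K → Agree b x K →
  (proj₁ x≺d ≡ K → cmpAt (isEven K) (entryAt b K) (entryAt d K)) → b ≺ d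
≺-agree-left {d = d} (m , x=d , x<d) m≤K (agree b=x) b<d with m≤n⇒m<n∨m≡n m≤K
... | inj₁ m<K = m , (λ j j<m → trans (b=x j (ℕₚ.<-trans j<m m<K)) (x=d j j<m)) ,
                 subst (λ e → cmpAt (isEven m) e (entryAt d m)) (sym (b=x m m<K)) x<d
... | inj₂ refl = m , (λ j j<m → trans (b=x j j<m) (x=d j j<m)) , b<d refl

Interval : C → C → C → Set
Interval c d y = c ≺ y × y ≺ d

Interval-open : ∀ c d → IsOpen (Interval c d)
Interval-open c d y (c≺y , y≺d) = c , d , c≺y , y≺d , λ z c≺z z≺d → c≺z , z≺d

spliceSeq : C → ℕ → ℤ → ℕ → ℤ
spliceSeq x K w j with <-cmp j K
... | tri< _ _ _ = value (entryAt x j)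
... | tri≈ _ _ _ = w
... | tri> _ _ _ = + 2

spliceSeq-< : ∀ x {K} w {j} → j ℕ.< K → spliceSeq x K w j ≡ value (entryAt x j)
spliceSeq-< x {K} w {j} j<K with <-cmp j K
... | tri< _ _ _ = refl
... | tri≈ j≮K _ _ = ⊥-elim (j≮K j<K)
... | tri> j≮K _ _ = ⊥-elim (j≮K j<K)

spliceSeq-at : ∀ x K w → spliceSeq x K w K ≡ w
spliceSeq-at x K w with <-cmp K K
... | tri< K<K _ _ = ⊥-elim (ℕₚ.<-irrefl refl K<K)
... | tri≈ _ _ _ = refl
... | tri> _ _ K<K = ⊥-elim (ℕₚ.<-irrefl refl K<K)

spliceSeq-suc : ∀ x K w → spliceSeq x K w (suc K) ≡ + 2
spliceSeq-suc x K w with <-cmp (suc K) K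
... | tri< _ _ K≯1+K = ⊥-elim (K≯1+K (ℕₚ.n<1+n K))
... | tri≈ _ _ K≯1+K = ⊥-elim (K≯1+K (ℕₚ.n<1+n K))
... | tri> _ _ _ = refl

spliceSeq-pos : ∀ x K w → (1 ℕ.≤ K → + 1 ℤ.≤ w) → ∀ j → + 1 ℤ.≤ spliceSeq x K w (suc j)
spliceSeq-pos x K w w-pos j with <-cmp (suc j) K
... | tri< _ _ _ = value-pos x (s≤s z≤n)
... | tri≈ _ refl _ = w-pos (s≤s z≤n)
... | tri> _ _ _ = +≤+ (s≤s z≤n)

splice : (x : C) (K : ℕ) (w : ℤ) → (1 ℕ.≤ K → + 1 ℤ.≤ w) → Ct
splice x K w w-pos = mkCt (suc K) (spliceSeq x K w ∘ toℕ) pos last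
  where
  pos : (i : Fin (suc (suc K))) → 1 ℕ.≤ toℕ i → + 1 ℤ.≤ spliceSeq x K w (toℕ i)
  pos (Fin.suc i) _ = spliceSeq-pos x K w w-pos (toℕ i)

  last : 1 ℕ.≤ suc K → + 2 ℤ.≤ spliceSeq x K w (toℕ (fromℕ (suc K)))
  last _ rewrite toℕ-fromℕ (suc K) | spliceSeq-suc x K w = ℤₚ.≤-refl

module _ (x : C) (K : ℕ) (w : ℤ) (w-pos : 1 ℕ.≤ K → + 1 ℤ.≤ w) where

  splice-entry : ∀ {j} → j ℕ.< suc (suc K) →
    entryAt (fin (splice x K w w-pos)) j ≡ val (spliceSeq x K w j)
  splice-entry = ∀toℕ⇒∀< (finEntry-toℕ (suc K) (spliceSeq x K w ∘ toℕ))

  splice-at : entryAt (fin (splice x K w w-pos)) K ≡ val w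
  splice-at = trans (splice-entry (ℕₚ.m≤n⇒m≤1+n (ℕₚ.n<1+n K))) (cong val (spliceSeq-at x K w))

  splice-agrees : (∀ j → j ℕ.< K → ∃ λ v → entryAt x j ≡ val v) →
    Agree (fin (splice x K w w-pos)) x K
  splice-agrees vals = agree agrees
    where
    agrees : ∀ j → j ℕ.< K → entryAt (fin (splice x K w w-pos)) j ≡ entryAt x j
    agrees j j<K with vals j j<K
    ... | v , x=v = begin
      entryAt (fin (splice x K w w-pos)) j
        ≡⟨ splice-entry (ℕₚ.m<n⇒m<1+n (ℕₚ.m<n⇒m<1+n j<K)) ⟩
      val (spliceSeq x K w j)    ≡⟨ cong val (spliceSeq-< x w j<K) ⟩
      val (value (entryAt x j))  ≡⟨ cong (val ∘ value) x=v ⟩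
      val v                      ≡⟨ sym x=v ⟩
      entryAt x j                ∎
      where open ≡-Reasoning

cylinder-inside-interval : ∀ {c x d} → c ≺ x → x ≺ d →
  Σ Ct λ a → ∀ b → Extends b a → Interval c d b
cylinder-inside-interval {c} {x} {d} c≺x@(k , _ , c<x) x≺d@(m , _ , x<d) = a , members
  where
  K : ℕ
  K = k ⊔ m

  x-defined : entryAt x K ≢ none
  x-defined with ⊔-sel k m
  ... | inj₁ K≡k = subst (λ i → entryAt x i ≢ none) (sym K≡k) (≺-right-defined {c} {x} c≺x)
  ... | inj₂ K≡m = subst (λ i → entryAt x i ≢ none) (sym K≡m) (≺-left-defined {x} {d} x≺d)

  open Approximant (approximate (isEven K) (entryAt c K) (entryAt x K) (entryAt d K))

  w-pos : 1 ℕ.≤ K → + 1 ℤ.≤ w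
  w-pos 1≤K = positive (value-pos x 1≤K)

  a : Ct
  a = splice x K w w-pos

  a=x : Agree (fin a) x K
  a=x = splice-agrees x K w w-pos (λ j j<K → entryAt-val-below x j<K x-defined)

  members : ∀ b → Extends b a → Interval c d b
  members b b⊒a = ≺-agree-right {c} c≺x (m≤m⊔n k m) (Agree-sym b=x) c<b ,
                  ≺-agree-left {d = d} x≺d (m≤n⊔m k m) b=x b<d
    where
    b=a : Agree b (fin a) (suc (suc K))
    b=a = Equivalence.to (Extends⇔Agree b a) b⊒a

    b=x : Agree b x K
    b=x = Agree-trans (Agree-≤ (ℕₚ.m≤n⇒m≤1+n (ℕₚ.n≤1+n K)) b=a) a=x

    b=w : entryAt b K ≡ val w
    b=w = trans (at b=a K (ℕₚ.m<n⇒m<1+n (ℕₚ.n<1+n K))) (splice-at x K w w-pos)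

    c<b : k ≡ K → cmpAt (isEven K) (entryAt c K) (entryAt b K)
    c<b k≡K = subst (cmpAt (isEven K) (entryAt c K)) (sym b=w)
                    (e<w (subst (λ i → cmpAt (isEven i) (entryAt c i) (entryAt x i)) k≡K c<x))

    b<d : m ≡ K → cmpAt (isEven K) (entryAt b K) (entryAt d K)
    b<d m≡K = subst (λ e → cmpAt (isEven K) e (entryAt d K)) (sym b=w)
                    (w<f (subst (λ i → cmpAt (isEven i) (entryAt x i) (entryAt d i)) m≡K x<d))

sandwich : ∀ b → Σ ℕ λ l → Σ ℕ λ h →
  cmpAt b (val (+ suc l)) (val (+ 2)) × cmpAt b (val (+ 2)) (val (+ suc h))
sandwich true  = 0 , 2 , val<val (+<+ (ℕₚ.n<1+n 1)) , val<val (+<+ (ℕₚ.n<1+n 2))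
sandwich false = 2 , 0 , val<val (+<+ (ℕₚ.n<1+n 2)) , val<val (+<+ (ℕₚ.n<1+n 1))

interval-inside-cylinder : ∀ a → Σ C λ p → Σ C λ q →
  Σ C (Interval p q) × (∀ y → Interval p q y → Extends y a)
interval-inside-cylinder a@(mkCt n e _ _) with sandwich (isEven (suc n))
... | l , h , l<2 , 2<h = P l , P h , (P 1 , P-≺ l<2 , P-≺ 2<h) , extends
  where
  x : C
  x = fin a

  positive : ∀ t → 1 ℕ.≤ suc n → + 1 ℤ.≤ + suc t
  positive t _ = +≤+ (s≤s z≤n)

  P : ℕ → C
  P t = fin (splice x (suc n) (+ suc t) (positive t))

  x-vals : ∀ j → j ℕ.< suc n → ∃ λ v → entryAt x j ≡ val v
  x-vals j = ∀toℕ⇒∀< (λ i → e i , finEntry-toℕ n e i)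

  P=x : ∀ t → Agree (P t) x (suc n)
  P=x t = splice-agrees x (suc n) (+ suc t) (positive t) x-vals

  P-top : ∀ t → entryAt (P t) (suc n) ≡ val (+ suc t)
  P-top t = splice-at x (suc n) (+ suc t) (positive t)

  P-≺ : ∀ {t u} → cmpAt (isEven (suc n)) (val (+ suc t)) (val (+ suc u)) → P t ≺ P u
  P-≺ {t} {u} t<u = suc n , at (Agree-trans (P=x t) (Agree-sym (P=x u))) ,
    subst₂ (cmpAt (isEven (suc n))) (sym (P-top t)) (sym (P-top u)) t<u

  extends : ∀ y → Interval (P l) (P h) y → Extends y a
  extends y (l≺y , y≺h) = Equivalence.from (Extends⇔Agree y a)
    (Agree-trans (Agree-sym l=y) (P=x l))
    where
    l=y : Agree (P l) y (suc n)
    l=y = Agree-between l≺y y≺h (Agree-trans (P=x l) (Agree-sym (P=x h)))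

lemma6 : (B : C → Set) → Dense B ⇔ ((a : Ct) → Σ C (λ b → B b × Extends b a))
lemma6 B = mk⇔ dense⇒hits hits⇒dense
  where
  dense⇒hits : Dense B → ∀ a → Σ C λ b → B b × Extends b a
  dense⇒hits dense a with interval-inside-cylinder a
  ... | p , q , nonempty , extends with dense (Interval p q) (Interval-open p q) nonempty
  ... | y , By , y∈pq = y , By , extends y y∈pq

  hits⇒dense : (∀ a → Σ C λ b → B b × Extends b a) → Dense B
  hits⇒dense hits U U-open (x , Ux) with U-open x Ux
  ... | c , d , c≺x , x≺d , cd⊆U with cylinder-inside-interval {c} {x} {d} c≺x x≺d
  ... | a , a⊆cd with hits a
  ... | b , Bb , b⊒a = b , Bb , uncurry (cd⊆U b) (a⊆cd b b⊒a)
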